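{- Let $X$ be a finite set of size $v$ and $1\le t\le s$. If there is a $(t,s,v)$-AONT, then there is an OA$(t,s,v)$.
   Context: A $(t,s,v)$-all-or-nothing transform (AONT) over an alphabet $X$ with $|X|=v$ is a bijection $\phi: X^s\to X^s$ such that for every $I\subseteq\{1,\dots,s\}$ with $|I|=t$ and every $J\subseteq\{1,\dots,s\}$ with $|J|=t$, the values of the inputs $x_i$ ($i\in I$) are completely undetermined given the outputs $y_j$ ($j\notin J$), where $\mathbf{y}=\phi(\mathbf{x})$; combinatorially, for every $\mathbf{a}\in X^{I}$ and every $\mathbf{b}\in X^{\{1,\dots,s\}\setminus J}$ there is exactly one $\mathbf{x}\in X^s$ with $\mathbf{x}|_I=\mathbf{a}$ and $\phi(\mathbf{x})|_{\{1,\dots,s\}\setminus J}=\mathbf{b}$. An OA$(t,k,v)$ (orthogonal array) is a $v^t\times k$ array with entries from a $v$-set such that in any $t$ columns every $t$-tuple of symbols occurs in exactly one row. -}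

module Defs where

open import Data.Nat using (ℕ; _^_)
open import Data.Fin using (Fin)
open import Data.Fin.Subset using (Subset; _∈_; _∉_; ∣_∣)
open import Data.Vec using (Vec; lookup)
open import Data.Product using (Σ; _×_; ∃)
open import Relation.Binary.PropositionalEquality using (_≡_)
open import Function.Bundles using (_⤖_; Bijection)

∃! : {A : Set} → (A → Set) → Set
∃! {A} P = Σ A λ x → P x × (∀ y → P y → y ≡ x)

AgreeOn : {X : Set} {s : ℕ} → Subset s → Vec X s → Vec X s → Set
AgreeOn I x a = ∀ i → i ∈ I → lookup x i ≡ lookup a i

AgreeOff : {X : Set} {s : ℕ} → Subset s → Vec X s → Vec X s → Set
AgreeOff J y b = ∀ j → j ∉ J → lookup y j ≡ lookup b j

-- A (t,s,|X|)-AONT: a bijection φ : X^s → X^s such that for all t-subsets I, J,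
-- every a ∈ X^I and every b ∈ X^{[s]∖J}, exactly one x has x|_I = a and
-- φ(x)|_{[s]∖J} = b.  (a, b are given as full vectors; only their entries on
-- I resp. outside J matter.)
IsAONT : (t s : ℕ) {X : Set} → (Vec X s ⤖ Vec X s) → Set
IsAONT t s {X} φ =
  (I J : Subset s) → ∣ I ∣ ≡ t → ∣ J ∣ ≡ t →
  (a b : Vec X s) →
  ∃! λ x → AgreeOn I x a × AgreeOff J (Bijection.to φ x) b

AONT : (t s : ℕ) (X : Set) → Set
AONT t s X = Σ (Vec X s ⤖ Vec X s) (IsAONT t s)

-- An OA(t,k,v) with symbols from X (|X| = v): a v^t × k array (rows indexed
-- by Fin (v ^ t)) such that for any t columns C and any t-tuple of symbols
-- (given as a full vector a, only entries in C matter) exactly one row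
-- agrees with it on C.
IsOA : (t k v : ℕ) {X : Set} → (Fin (v ^ t) → Vec X k) → Set
IsOA t k v {X} A =
  (C : Subset k) → ∣ C ∣ ≡ t → (a : Vec X k) →
  ∃! λ r → AgreeOn C (A r) a

OA : (t k v : ℕ) (X : Set) → Set
OA t k v X = Σ (Fin (v ^ t) → Vec X k) (IsOA t k v)

module Submission where

-- The rows of the orthogonal array are the inputs x whose image φ(x) takes a fixed
-- value b outside a fixed t-set J.  For any t columns C and any prescribed values
-- a on C, the AONT property gives exactly one such x with x|_C = a; taking C to be
-- the first t coordinates shows there are exactly v^t of them, indexed by x|_C.

open import Defs
open import Data.Nat using (ℕ; zero; suc; _≤_; _^_; z≤n; s≤s)
open import Data.Fin using (Fin; zero; suc)
open import Data.Fin.Properties using (*↔×; ¬Fin0)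
open import Data.Fin.Subset using (Subset; ∣_∣; ⊥)
open import Data.Fin.Subset.Properties using (∉⊥)
open import Data.Vec using (Vec; []; _∷_; head; replicate; here; there)
open import Data.Bool using (true)
open import Data.Product using (_×_; _,_; proj₁; proj₂; uncurry)
open import Data.Product.Function.NonDependent.Propositional using (_×-↔_)
open import Relation.Nullary using (¬_; contradiction)
open import Relation.Binary.PropositionalEquality using (_≡_; refl; sym; trans; cong; cong₂; subst; module ≡-Reasoning)
open import Function.Bundles using (_↔_; _⤖_; Inverse; Bijection; mk↔ₛ′)
open import Function.Base using (_∘_)
open import Function.Properties.Inverse using (↔-trans; ↔-sym)

private
  variable
    X : Set
    s t v : ℕ

Vec-suc↔× : Vec X (suc t) ↔ (X × Vec X t)
Vec-suc↔× = mk↔ₛ′ (λ { (x ∷ xs) → x , xs }) (uncurry _∷_) (λ _ → refl) (λ { (_ ∷ _) → refl })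

Vec↔Fin^ : X ↔ Fin v → (t : ℕ) → Vec X t ↔ Fin (v ^ t)
Vec↔Fin^ X↔Fin zero = mk↔ₛ′ (λ _ → zero) (λ _ → []) (λ { zero → refl }) (λ { [] → refl })
Vec↔Fin^ X↔Fin (suc t) =
  ↔-trans Vec-suc↔× (↔-trans (X↔Fin ×-↔ Vec↔Fin^ X↔Fin t) (↔-sym *↔×))

initial : t ≤ s → Subset s
initial z≤n     = ⊥
initial (s≤s p) = true ∷ initial p

∣initial∣≡ : (p : t ≤ s) → ∣ initial p ∣ ≡ t
∣initial∣≡ {s = zero}  z≤n     = refl
∣initial∣≡ {s = suc s} z≤n     = ∣initial∣≡ {s = s} z≤n
∣initial∣≡             (s≤s p) = cong suc (∣initial∣≡ p)

restrict : t ≤ s → Vec X s → Vec X t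
restrict z≤n     _        = []
restrict (s≤s p) (x ∷ xs) = x ∷ restrict p xs

pad : X → t ≤ s → Vec X t → Vec X s
pad x₀ z≤n     []       = replicate _ x₀
pad x₀ (s≤s p) (x ∷ xs) = x ∷ pad x₀ p xs

agreeOn-initial⇒restrict≡ : (x₀ : X) (p : t ≤ s) (x : Vec X s) (u : Vec X t) →
  AgreeOn (initial p) x (pad x₀ p u) → restrict p x ≡ u
agreeOn-initial⇒restrict≡ x₀ z≤n     x        []       agree = refl
agreeOn-initial⇒restrict≡ x₀ (s≤s p) (y ∷ x) (w ∷ u) agree =
  cong₂ _∷_ (agree zero here)
            (agreeOn-initial⇒restrict≡ x₀ p x u (λ i i∈ → agree (suc i) (there i∈)))

agreeOn-initial-pad-restrict : (x₀ : X) (p : t ≤ s) (x : Vec X s) →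
  AgreeOn (initial p) x (pad x₀ p (restrict p x))
agreeOn-initial-pad-restrict x₀ z≤n     x       i       i∈⊥        = contradiction i∈⊥ ∉⊥
agreeOn-initial-pad-restrict x₀ (s≤s p) (y ∷ x) zero    here       = refl
agreeOn-initial-pad-restrict x₀ (s≤s p) (y ∷ x) (suc i) (there i∈) =
  agreeOn-initial-pad-restrict x₀ p x i i∈

Orthogonal : (t : ℕ) → (Vec X s → Set) → Set
Orthogonal {X = X} {s = s} t S =
  (C : Subset s) → ∣ C ∣ ≡ t → (a : Vec X s) → ∃! λ x → AgreeOn C x a × S x

AONT-fibre-orthogonal : (φ : Vec X s ⤖ Vec X s) → IsAONT t s φ →
  (J : Subset s) → ∣ J ∣ ≡ t → (b : Vec X s) →
  Orthogonal t (λ x → AgreeOff J (Bijection.to φ x) b)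
AONT-fibre-orthogonal φ aont J ∣J∣≡t b C ∣C∣≡t a = aont C J ∣C∣≡t ∣J∣≡t a b

module _ {S : Vec X s → Set} (orth : Orthogonal t S)
         (x₀ : X) (p : t ≤ s) (code : Vec X t ↔ Fin (v ^ t)) where

  open Inverse code using (to; from; strictlyInverseˡ; strictlyInverseʳ)

  private
    completion : (u : Vec X t) → ∃! λ x → AgreeOn (initial p) x (pad x₀ p u) × S x
    completion u = orth (initial p) (∣initial∣≡ p) (pad x₀ p u)

  row : Fin (v ^ t) → Vec X s
  row r = proj₁ (completion (from r))

  row∈S : (r : Fin (v ^ t)) → S (row r)
  row∈S r = proj₂ (proj₁ (proj₂ (completion (from r))))

  restrict-row : (r : Fin (v ^ t)) → restrict p (row r) ≡ from r
  restrict-row r = agreeOn-initial⇒restrict≡ x₀ p (row r) (from r)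
                     (proj₁ (proj₁ (proj₂ (completion (from r)))))

  row-restrict : {x : Vec X s} → S x → row (to (restrict p x)) ≡ x
  row-restrict {x} x∈S = sym (proj₂ (proj₂ (completion (from (to (restrict p x))))) x
    ( subst (λ u → AgreeOn (initial p) x (pad x₀ p u))
            (sym (strictlyInverseʳ (restrict p x)))
            (agreeOn-initial-pad-restrict x₀ p x)
    , x∈S))

  row-injective : {r r′ : Fin (v ^ t)} → row r ≡ row r′ → r ≡ r′
  row-injective {r} {r′} eq = begin
    r                            ≡⟨ strictlyInverseˡ r ⟨
    to (from r)                  ≡⟨ cong to (restrict-row r) ⟨
    to (restrict p (row r))      ≡⟨ cong (to ∘ restrict p) eq ⟩
    to (restrict p (row r′))     ≡⟨ cong to (restrict-row r′) ⟩
    to (from r′)                 ≡⟨ strictlyInverseˡ r′ ⟩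
    r′                           ∎
    where open ≡-Reasoning

  row-isOA : IsOA t s v row
  row-isOA C ∣C∣≡t a with orth C ∣C∣≡t a
  ... | x , (x|C≡a , x∈S) , unique =
    to (restrict p x)
    , subst (λ y → AgreeOn C y a) (sym (row-restrict x∈S)) x|C≡a
    , λ r′ row-r′|C≡a → row-injective
        (trans (unique (row r′) (row-r′|C≡a , row∈S r′)) (sym (row-restrict x∈S)))

  orthogonal⇒OA : OA t s v X
  orthogonal⇒OA = row , row-isOA

emptyAlphabet-OA : ¬ X → OA (suc t) (suc s) 0 X
emptyAlphabet-OA ¬X = (λ ()) , λ _ _ a → contradiction (head a) ¬X

theorem22 : (X : Set) (v t s : ℕ) → X ↔ Fin v → 1 ≤ t → t ≤ s →
    AONT t s X → OA t s v X
theorem22 X zero    (suc t) (suc s) X↔Fin _ _ _ = emptyAlphabet-OA (¬Fin0 ∘ Inverse.to X↔Fin)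
theorem22 X (suc v) t       s       X↔Fin _ t≤s (φ , aont) =
  orthogonal⇒OA (AONT-fibre-orthogonal φ aont (initial t≤s) (∣initial∣≡ t≤s) (replicate s x₀))
                x₀ t≤s (Vec↔Fin^ X↔Fin t)
  where x₀ = Inverse.from X↔Fin zero
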